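{- Let $k\geq 2$ and let $G_k$ and $G_{k+1}$ be the graphs defined below (for $\ell = 1$). Let $\varphi$ be the map on nodes of $G_k$ given by $\varphi(0)=0$ and $\varphi(m)=m+2^k$ for $m\neq 0$. Then $\varphi$ is a bijection from the nodes of $G_k$ onto the nodes of $B_1$ of $G_{k+1}$; for every edge of $G_k$ other than the red edge from $0$ to $2^{k-1}-1$, its image under $\varphi$ is an edge of $B_1$ of $G_{k+1}$ of the same color, and every edge of $B_1$ of $G_{k+1}$ arises in this way. Moreover, in $G_{k+1}$ the node $I_b^{k+1}$ has exactly two incoming edges: a blue edge from $II_t^{k+1}$ and a red edge from $II_b^{k+1}$ (instead of an edge from $0$).
   Context: The pruning function $\operatorname{P}_{1}:\mathbb{Z}_{>0}\to\mathbb{Z}_{\geq 0}$: write $m$ in binary, padded on the left with zeros as needed, let $z$ be the position (position $0$ = least significant bit) of the first zero bit counted from the right, let $q = 2^{z}\lfloor m/2^{z}\rfloor$, and set $\operatorname{P}_1(m)=\max(q-1,0)$. For an integer $k\ge 2$, $G_k$ is the directed graph with node set $\{0\}\cup\{2^{k-1}-1,\ldots,2^k-1\}$ and edges: for each $m$ with $2^{k-1}-1\le m<2^k-1$, a "blue" edge from $m$ to $m+1$ and a "red" edge from $\operatorname{P}_1(m)$ to $m$ (blue edges carry a fixed weight $-n$, red edges weight $+1$). For $k\ge 3$ set $I_t^k = 2^k-1$, $I_b^k=2^k-2^{k-2}-1$, $II_t^k=2^k-2^{k-2}-2$, $II_b^k=2^{k-1}-1$. $B_1$ of $G_k$ is the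 induced subgraph of $G_k$ on $\{0\}\cup\{I_b^k,\ldots,I_t^k\}$, and $B_2$ of $G_k$ is the induced subgraph on $\{0\}\cup\{II_b^k,\ldots,II_t^k\}$. -}

module Defs where

open import Data.Nat using (ℕ; zero; suc; _+_; _*_; _∸_; _^_; _≤_; _<_; _≡ᵇ_)
open import Data.Nat.DivMod using (_/_; _%_)
open import Data.Bool using (if_then_else_)
open import Data.Product using (_×_)
open import Data.Sum using (_⊎_)
open import Data.Nat.Properties using (m^n≢0)
open import Relation.Binary.PropositionalEquality using (_≡_)

-- Position (0 = least significant) of the first zero bit of m counted from
-- the right, computed with fuel f (fuel m suffices since m halves each step).
firstZeroFuel : ℕ → ℕ → ℕ
firstZeroFuel zero    m = 0
firstZeroFuel (suc f) m = if (m % 2 ≡ᵇ 0) then 0 else suc (firstZeroFuel f (m / 2))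

firstZero : ℕ → ℕ
firstZero m = firstZeroFuel (suc m) m

P₁ : ℕ → ℕ
P₁ m = (2 ^ firstZero m) * (m / (2 ^ firstZero m)) ∸ 1
  where instance _ = m^n≢0 2 (firstZero m)

-- Colours of edges (blue edges carry weight -n, red edges weight +1).
data Colour : Set where
  blue red : Colour

low high : ℕ → ℕ
low  k = 2 ^ (k ∸ 1) ∸ 1
high k = 2 ^ k ∸ 1

Node : ℕ → ℕ → Set
Node k m = m ≡ 0 ⊎ (low k ≤ m × m ≤ high k)

data Edge (k : ℕ) : Colour → ℕ → ℕ → Set where
  blueEdge : ∀ m → low k ≤ m → m < high k → Edge k blue m (suc m)
  redEdge  : ∀ m → low k ≤ m → m < high k → Edge k red (P₁ m) m

-- Block boundaries (for k ≥ 3).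
Iₜ Iᵦ IIₜ IIᵦ : ℕ → ℕ
Iₜ  k = 2 ^ k ∸ 1
Iᵦ  k = 2 ^ k ∸ 2 ^ (k ∸ 2) ∸ 1
IIₜ k = 2 ^ k ∸ 2 ^ (k ∸ 2) ∸ 2
IIᵦ k = 2 ^ (k ∸ 1) ∸ 1

B₁Node : ℕ → ℕ → Set
B₁Node k m = m ≡ 0 ⊎ (Iᵦ k ≤ m × m ≤ Iₜ k)

B₁Edge : ℕ → Colour → ℕ → ℕ → Set
B₁Edge k c a b = Edge k c a b × B₁Node k a × B₁Node k b

φ : ℕ → ℕ → ℕ
φ k zero    = zero
φ k (suc m) = suc m + 2 ^ k

-- P₁ m clears the trailing 1-bits of m and then subtracts one. Adding 2^k to a
-- number m with m + 1 < 2^k leaves its trailing ones untouched, so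
-- P₁ (m + 2^k) = P₁ m + 2^k as soon as m has a 1-bit above its trailing ones;
-- this holds for every node of G_k above 2^(k-1) - 1, and translating by 2^k
-- then carries the edges of G_k onto those of B₁ of G_(k+1). The exception is
-- the all-ones number 2^(k-1) - 1: P₁ sends it to 0, but sends its translate
-- Iᵦ^(k+1) to 2^k - 1 = IIᵦ^(k+1), which lies outside B₁.
module Submission where

open import Data.Bool using (true; false)
open import Data.Empty using (⊥-elim)
open import Data.List using (_∷_; [])
open import Data.Nat
open import Data.Nat.DivMod
open import Data.Nat.Divisibility using (divides-refl)
open import Data.Nat.Properties
open import Data.Nat.Tactic.RingSolver using (solve)
open import Data.Product using (_×_; ∃-syntax; _,_; uncurry)
open import Data.Sum using (_⊎_; inj₁; inj₂)
open import Function.Bundles using (_⇔_; mk⇔)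
open import Relation.Nullary using (¬_)
open import Relation.Binary.PropositionalEquality

open import Defs

data EvenOdd : ℕ → Set where
  even : ∀ r → EvenOdd (2 * r)
  odd  : ∀ r → EvenOdd (1 + 2 * r)

evenOdd : ∀ m → EvenOdd m
evenOdd zero = even 0
evenOdd (suc m) with evenOdd m
... | even r = odd r
... | odd r  = subst EvenOdd (*-suc 2 r) (even (suc r))

[2*r]%2≡0 : ∀ r → (2 * r) % 2 ≡ 0
[2*r]%2≡0 r rewrite *-comm 2 r = m*n%n≡0 r 2

[1+2*r]%2≡1 : ∀ r → (1 + 2 * r) % 2 ≡ 1
[1+2*r]%2≡1 r rewrite *-comm 2 r = [m+kn]%n≡m%n 1 r 2

[1+2*r]/2≡r : ∀ r → (1 + 2 * r) / 2 ≡ r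
[1+2*r]/2≡r r rewrite *-comm 2 r = trans (+-distrib-/-∣ʳ 1 {d = 2} (divides-refl r)) (m*n/n≡m r 2)

firstZeroFuel-irrelevant : ∀ f g m → m < f → m < g → firstZeroFuel f m ≡ firstZeroFuel g m
firstZeroFuel-irrelevant (suc f) (suc g) zero    _       _       = refl
firstZeroFuel-irrelevant (suc f) (suc g) (suc m) (s≤s p) (s≤s q) with suc m % 2 ≡ᵇ 0
... | true  = refl
... | false = cong suc (firstZeroFuel-irrelevant f g (suc m / 2) (<-≤-trans halved p) (<-≤-trans halved q))
  where halved : suc m / 2 < suc m
        halved = m/n<m (suc m) 2 (s≤s (s≤s z≤n))

firstZero-even : ∀ r → firstZero (2 * r) ≡ 0
firstZero-even r rewrite [2*r]%2≡0 r = refl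

firstZero-odd : ∀ r → firstZero (1 + 2 * r) ≡ suc (firstZero r)
firstZero-odd r rewrite [1+2*r]%2≡1 r | [1+2*r]/2≡r r =
  cong suc (firstZeroFuel-irrelevant (suc (2 * r)) (suc r) r (s≤s (m≤m+n r _)) ≤-refl)

roundDown : ℕ → ℕ → ℕ
roundDown z m = 2 ^ z * (m / 2 ^ z)
  where instance _ = m^n≢0 2 z

roundDown-zero : ∀ m → roundDown 0 m ≡ m
roundDown-zero m = trans (+-identityʳ (m / 1)) (n/1≡n m)

roundDown-odd : ∀ z r → roundDown (suc z) (1 + 2 * r) ≡ 2 * roundDown z r
roundDown-odd z r = begin
  2 * 2 ^ z * ((1 + 2 * r) / (2 * 2 ^ z)) ≡⟨ cong (2 * 2 ^ z *_) (sym (m/n/o≡m/[n*o] (1 + 2 * r) 2 (2 ^ z))) ⟩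
  2 * 2 ^ z * ((1 + 2 * r) / 2 / 2 ^ z)   ≡⟨ cong (λ x → 2 * 2 ^ z * (x / 2 ^ z)) ([1+2*r]/2≡r r) ⟩
  2 * 2 ^ z * (r / 2 ^ z)                 ≡⟨ *-assoc 2 (2 ^ z) _ ⟩
  2 * roundDown z r                       ∎
  where open ≡-Reasoning
        instance _ = m^n≢0 2 z
                 _ = m^n≢0 2 (suc z)

-- P₁ m is definitionally clearTrailingOnes m ∸ 1.
clearTrailingOnes : ℕ → ℕ
clearTrailingOnes m = roundDown (firstZero m) m

clearTrailingOnes-even : ∀ r → clearTrailingOnes (2 * r) ≡ 2 * r
clearTrailingOnes-even r rewrite firstZero-even r = roundDown-zero (2 * r)

clearTrailingOnes-odd : ∀ r → clearTrailingOnes (1 + 2 * r) ≡ 2 * clearTrailingOnes r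
clearTrailingOnes-odd r rewrite firstZero-odd r = roundDown-odd (firstZero r) r

clearTrailingOnes-≤ : ∀ m → clearTrailingOnes m ≤ m
clearTrailingOnes-≤ m = subst (_≤ m) (*-comm (m / 2 ^ z) (2 ^ z)) (m/n*n≤m m (2 ^ z))
  where z = firstZero m
        instance _ = m^n≢0 2 z

clearTrailingOnes-allOnes : ∀ n {m} → suc m ≡ 2 ^ n → clearTrailingOnes m ≡ 0
clearTrailingOnes-allOnes zero    {zero} _ = refl
clearTrailingOnes-allOnes (suc n) {m} eq with evenOdd m
... | even r = ⊥-elim (even≢odd (2 ^ n) r (sym eq))
... | odd r  = trans (clearTrailingOnes-odd r)
                     (cong (2 *_) (clearTrailingOnes-allOnes n (*-cancelˡ-≡ (suc r) (2 ^ n) 2 eq′)))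
  where eq′ : 2 * suc r ≡ 2 * 2 ^ n
        eq′ = trans (*-suc 2 r) eq

clearTrailingOnes-+-2^ : ∀ n {m} → suc m < 2 ^ n →
                         clearTrailingOnes (m + 2 ^ n) ≡ clearTrailingOnes m + 2 ^ n
clearTrailingOnes-+-2^ zero    (s≤s ())
clearTrailingOnes-+-2^ (suc n) {m} lt with evenOdd m
... | even r = begin
  clearTrailingOnes (2 * r + 2 * 2 ^ n)   ≡⟨ cong clearTrailingOnes (sym (*-distribˡ-+ 2 r (2 ^ n))) ⟩
  clearTrailingOnes (2 * (r + 2 ^ n))     ≡⟨ clearTrailingOnes-even (r + 2 ^ n) ⟩
  2 * (r + 2 ^ n)                         ≡⟨ *-distribˡ-+ 2 r (2 ^ n) ⟩
  2 * r + 2 * 2 ^ n                       ≡⟨ cong (_+ 2 * 2 ^ n) (sym (clearTrailingOnes-even r)) ⟩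
  clearTrailingOnes (2 * r) + 2 * 2 ^ n   ∎
  where open ≡-Reasoning
... | odd r = begin
  clearTrailingOnes (1 + 2 * r + 2 * 2 ^ n)   ≡⟨ cong (λ x → clearTrailingOnes (1 + x)) (sym (*-distribˡ-+ 2 r (2 ^ n))) ⟩
  clearTrailingOnes (1 + 2 * (r + 2 ^ n))     ≡⟨ clearTrailingOnes-odd (r + 2 ^ n) ⟩
  2 * clearTrailingOnes (r + 2 ^ n)           ≡⟨ cong (2 *_) (clearTrailingOnes-+-2^ n r<) ⟩
  2 * (clearTrailingOnes r + 2 ^ n)           ≡⟨ *-distribˡ-+ 2 (clearTrailingOnes r) (2 ^ n) ⟩
  2 * clearTrailingOnes r + 2 * 2 ^ n         ≡⟨ cong (_+ 2 * 2 ^ n) (sym (clearTrailingOnes-odd r)) ⟩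
  clearTrailingOnes (1 + 2 * r) + 2 * 2 ^ n   ∎
  where open ≡-Reasoning
        r< : suc r < 2 ^ n
        r< = *-cancelˡ-< 2 (suc r) (2 ^ n) (subst (_< 2 * 2 ^ n) (sym (*-suc 2 r)) lt)

2^n≤clearTrailingOnes : ∀ n {m} → 2 ^ n ≤ m → suc m < 2 ^ suc n → 2 ^ n ≤ clearTrailingOnes m
2^n≤clearTrailingOnes n {m} 2^n≤m lt = subst (2 ^ n ≤_) (sym clear-m) (m≤n+m (2 ^ n) _)
  where r = m ∸ 2 ^ n
        m≡ : r + 2 ^ n ≡ m
        m≡ = m∸n+n≡m 2^n≤m
        r< : suc r < 2 ^ n
        r< = +-cancelʳ-< (2 ^ n) (suc r) (2 ^ n)
               (subst₂ _<_ (cong suc (sym m≡)) (cong (2 ^ n +_) (+-identityʳ (2 ^ n))) lt)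
        clear-m : clearTrailingOnes m ≡ clearTrailingOnes r + 2 ^ n
        clear-m = trans (cong clearTrailingOnes (sym m≡)) (clearTrailingOnes-+-2^ n r<)

P₁-+-2^ : ∀ n {m} → suc m < 2 ^ n → 1 ≤ clearTrailingOnes m → P₁ (m + 2 ^ n) ≡ P₁ m + 2 ^ n
P₁-+-2^ n lt 1≤ = trans (cong (_∸ 1) (clearTrailingOnes-+-2^ n lt)) (+-∸-comm (2 ^ n) 1≤)

suc[2^n∸1]≡2^n : ∀ n → suc (2 ^ n ∸ 1) ≡ 2 ^ n
suc[2^n∸1]≡2^n n = trans (+-comm 1 _) (m∸n+n≡m (m^n>0 2 n))

high<2^ : ∀ k → high k < 2 ^ k
high<2^ k = ≤-reflexive (suc[2^n∸1]≡2^n k)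

high-suc : ∀ k → high (suc k) ≡ high k + 2 ^ k
high-suc k = trans (cong (_∸ 1) (cong (2 ^ k +_) (+-identityʳ (2 ^ k))))
                   (+-∸-comm (2 ^ k) (m^n>0 2 k))

Iᵦ-suc : ∀ n → Iᵦ (suc (suc n)) ≡ low (suc n) + 2 ^ suc n
Iᵦ-suc n = closedForm (2 ^ n) (m^n>0 2 n)
  where closedForm : ∀ T → 0 < T → 2 * (2 * T) ∸ T ∸ 1 ≡ (T ∸ 1) + 2 * T
        closedForm (suc t) _ = cong (_∸ 1) (trans (cong (_∸ suc t) split) (m+n∸m≡n (suc t) _))
          where split : 2 * (2 * suc t) ≡ suc t + suc (t + 2 * suc t)
                split = solve (t ∷ [])

suc-IIₜ : ∀ n → suc (IIₜ (suc (suc n))) ≡ Iᵦ (suc (suc n))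
suc-IIₜ n = suc[m∸2]≡m∸1 (2 ^ suc (suc n) ∸ 2 ^ n) Iᵦ-pos
  where suc[m∸2]≡m∸1 : ∀ m → 0 < m ∸ 1 → suc (m ∸ 2) ≡ m ∸ 1
        suc[m∸2]≡m∸1 (suc (suc m)) _ = refl
        Iᵦ-pos : 0 < Iᵦ (suc (suc n))
        Iᵦ-pos = subst (0 <_) (sym (Iᵦ-suc n)) (≤-trans (m^n>0 2 (suc n)) (m≤n+m _ (low (suc n))))

φ-injective : ∀ k {m m′} → φ k m ≡ φ k m′ → m ≡ m′
φ-injective k {zero}  {zero}   _  = refl
φ-injective k {suc m} {suc m′} eq = +-cancelʳ-≡ (2 ^ k) (suc m) (suc m′) eq

φ-pos : ∀ k {m} → 1 ≤ m → φ k m ≡ m + 2 ^ k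
φ-pos k {suc m} _ = refl

-- low (suc k) and IIᵦ (suc k) are both definitionally high k.
+2^-inside : ∀ k {m} → m < high k → low (suc k) ≤ m + 2 ^ k × m + 2 ^ k < high (suc k)
+2^-inside k {m} m<high =
    ≤-trans (<⇒≤ (high<2^ k)) (m≤n+m (2 ^ k) m)
  , subst (m + 2 ^ k <_) (sym (high-suc k)) (+-monoˡ-< (2 ^ k) m<high)

+2^-<high⁻¹ : ∀ k {m} → m + 2 ^ k < high (suc k) → m < high k
+2^-<high⁻¹ k {m} lt = +-cancelʳ-< (2 ^ k) m (high k) (subst (m + 2 ^ k <_) (high-suc k) lt)

shiftBlue : ∀ k {m} → m < high k → Edge (suc k) blue (m + 2 ^ k) (suc m + 2 ^ k)
shiftBlue k m<high = uncurry (blueEdge _) (+2^-inside k m<high)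

shiftRed : ∀ k {m} → m < high k → Edge (suc k) red (P₁ (m + 2 ^ k)) (m + 2 ^ k)
shiftRed k m<high = uncurry (redEdge _) (+2^-inside k m<high)

RootEdge : ℕ → Colour → ℕ → ℕ → Set
RootEdge k c a b = c ≡ red × a ≡ 0 × b ≡ low k

module Doubling (n : ℕ) (1≤n : 1 ≤ n) where

  k : ℕ
  k = suc n

  low-pos : 1 ≤ low k
  low-pos = ∸-monoˡ-≤ 1 (^-monoʳ-≤ 2 1≤n)

  low<high : low k < high k
  low<high = subst (low k <_) (sym (high-suc n)) (m<m+n (low k) (m^n>0 2 n))

  high-pos : 0 < high k
  high-pos = ≤-trans low-pos (<⇒≤ low<high)

  φ-onRange : ∀ {m} → low k ≤ m → φ k m ≡ m + 2 ^ k
  φ-onRange l = φ-pos k (≤-trans low-pos l)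

  P₁-low : P₁ (low k) ≡ 0
  P₁-low = cong (_∸ 1) (clearTrailingOnes-allOnes n (suc[2^n∸1]≡2^n n))

  P₁-low-shift : P₁ (low k + 2 ^ k) ≡ high k
  P₁-low-shift = cong (_∸ 1) (begin
    clearTrailingOnes (low k + 2 ^ k)   ≡⟨ clearTrailingOnes-+-2^ k (≤-trans (s≤s low<high) (high<2^ k)) ⟩
    clearTrailingOnes (low k) + 2 ^ k   ≡⟨ cong (_+ 2 ^ k) (clearTrailingOnes-allOnes n (suc[2^n∸1]≡2^n n)) ⟩
    2 ^ k                               ∎)
    where open ≡-Reasoning

  P₁-upper : ∀ {m} → low k < m → m < high k →
             low k ≤ P₁ m × P₁ m ≤ high k × P₁ (m + 2 ^ k) ≡ P₁ m + 2 ^ k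
  P₁-upper {m} low<m m<high =
      ∸-monoˡ-≤ 1 2^n≤clear
    , ≤-trans (m∸n≤m _ 1) (≤-trans (clearTrailingOnes-≤ m) (<⇒≤ m<high))
    , P₁-+-2^ k sucm<2^k (≤-trans (m^n>0 2 n) 2^n≤clear)
    where sucm<2^k : suc m < 2 ^ k
          sucm<2^k = <-≤-trans (s≤s m<high) (high<2^ k)
          2^n≤clear : 2 ^ n ≤ clearTrailingOnes m
          2^n≤clear = 2^n≤clearTrailingOnes n (subst (_≤ m) (suc[2^n∸1]≡2^n n) low<m) sucm<2^k

  B₁-shift : ∀ {a} → low k ≤ a → a ≤ high k → B₁Node (suc k) (a + 2 ^ k)
  B₁-shift {a} l u = inj₂ ( subst (_≤ a + 2 ^ k) (sym (Iᵦ-suc n)) (+-monoˡ-≤ (2 ^ k) l)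
                          , subst (a + 2 ^ k ≤_) (sym (high-suc k)) (+-monoˡ-≤ (2 ^ k) u))

  B₁-unshift : ∀ {m′} → Iᵦ (suc k) ≤ m′ → m′ ≤ Iₜ (suc k) →
               ∃[ a ] (low k ≤ a × a ≤ high k × a + 2 ^ k ≡ m′)
  B₁-unshift {m′} l u with m≤n⇒∃[o]m+o≡n (subst (_≤ m′) (Iᵦ-suc n) l)
  ... | d , eq = low k + d , m≤m+n (low k) d , a≤high , a+2^k≡m′
    where a+2^k≡m′ : low k + d + 2 ^ k ≡ m′
          a+2^k≡m′ = trans (+-assoc (low k) d _)
                           (trans (cong (low k +_) (+-comm d _)) (trans (sym (+-assoc (low k) _ d)) eq))
          a≤high : low k + d ≤ high k
          a≤high = +-cancelʳ-≤ (2 ^ k) _ (high k) (subst₂ _≤_ (sym a+2^k≡m′) (high-suc k) u)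

  B₁-above : ∀ {m′} → high k ≤ m′ → B₁Node (suc k) m′ →
             ∃[ a ] (low k ≤ a × a ≤ high k × a + 2 ^ k ≡ m′)
  B₁-above h≤ (inj₁ refl) = ⊥-elim (<⇒≱ high-pos h≤)
  B₁-above _  (inj₂ (l , u)) = B₁-unshift l u

  high∉B₁ : ¬ B₁Node (suc k) (high k)
  high∉B₁ (inj₁ h≡0) = <⇒≱ high-pos (≤-reflexive h≡0)
  high∉B₁ (inj₂ (l , _)) =
    <⇒≱ (high<2^ k) (≤-trans (m≤n+m (2 ^ k) (low k)) (subst (_≤ high k) (Iᵦ-suc n) l))

  φ-node : ∀ {m} → Node k m → B₁Node (suc k) (φ k m)
  φ-node (inj₁ refl)    = inj₁ refl
  φ-node (inj₂ (l , u)) = subst (B₁Node (suc k)) (sym (φ-onRange l)) (B₁-shift l u)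

  φ-onto : ∀ {m′} → B₁Node (suc k) m′ → ∃[ m ] (Node k m × φ k m ≡ m′)
  φ-onto (inj₁ refl) = 0 , inj₁ refl , refl
  φ-onto (inj₂ (l , u)) with B₁-unshift l u
  ... | a , la , ua , eq = a , inj₂ (la , ua) , trans (φ-onRange la) eq

  φ-edge : ∀ {c a b} → Edge k c a b → ¬ RootEdge k c a b → B₁Edge (suc k) c (φ k a) (φ k b)
  φ-edge (blueEdge m l u) _ =
      subst (λ x → Edge (suc k) blue x (suc m + 2 ^ k)) (sym (φ-onRange l)) (shiftBlue k u)
    , φ-node (inj₂ (l , <⇒≤ u)) , φ-node (inj₂ (≤-trans l (n≤1+n m) , u))
  φ-edge (redEdge m l u) ¬root with m≤n⇒m<n∨m≡n l
  ... | inj₂ refl = ⊥-elim (¬root (refl , P₁-low , refl))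
  ... | inj₁ low<m with P₁-upper low<m u
  ...   | lP , uP , shifted =
      subst₂ (Edge (suc k) red) (trans shifted (sym (φ-onRange lP))) (sym (φ-onRange l)) (shiftRed k u)
    , φ-node (inj₂ (lP , uP)) , φ-node (inj₂ (l , <⇒≤ u))

  φ-edge-onto : ∀ {c a′ b′} → B₁Edge (suc k) c a′ b′ →
                ∃[ a ] ∃[ b ] (Edge k c a b × ¬ RootEdge k c a b × φ k a ≡ a′ × φ k b ≡ b′)
  φ-edge-onto (blueEdge m′ l u , src , _) with B₁-above l src
  ... | a , la , _ , refl =
    a , suc a , blueEdge a la (+2^-<high⁻¹ k u) , (λ { (() , _) }) , φ-onRange la , refl
  φ-edge-onto (redEdge m′ l u , src , tgt) with B₁-above l tgt
  ... | a , la , _ , refl with m≤n⇒m<n∨m≡n la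
  ...   | inj₂ refl = ⊥-elim (high∉B₁ (subst (B₁Node (suc k)) P₁-low-shift src))
  ...   | inj₁ low<a with P₁-upper low<a (+2^-<high⁻¹ k u)
  ...     | lP , _ , shifted =
    P₁ a , a , redEdge a la (+2^-<high⁻¹ k u) , (λ { (_ , _ , a≡low) → <-irrefl (sym a≡low) low<a })
    , trans (φ-onRange lP) (sym shifted) , φ-onRange la

  incoming-Iᵦ⁺ : ∀ {c a b} → Edge (suc k) c a b → b ≡ Iᵦ (suc k) →
                 (c ≡ blue × a ≡ IIₜ (suc k)) ⊎ (c ≡ red × a ≡ IIᵦ (suc k))
  incoming-Iᵦ⁺ (blueEdge m _ _) eq = inj₁ (refl , suc-injective (trans eq (sym (suc-IIₜ n))))
  incoming-Iᵦ⁺ (redEdge m _ _)  eq = inj₂ (refl , trans (cong P₁ (trans eq (Iᵦ-suc n))) P₁-low-shift)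

  incoming-Iᵦ⁻ : ∀ {c a} → (c ≡ blue × a ≡ IIₜ (suc k)) ⊎ (c ≡ red × a ≡ IIᵦ (suc k)) →
                 Edge (suc k) c a (Iᵦ (suc k))
  incoming-Iᵦ⁻ (inj₁ (refl , refl)) =
    subst (Edge (suc k) blue (IIₜ (suc k))) (suc-IIₜ n) (blueEdge (IIₜ (suc k)) l u)
    where Iᵦ≡ : suc (IIₜ (suc k)) ≡ low k + 2 ^ k
          Iᵦ≡ = trans (suc-IIₜ n) (Iᵦ-suc n)
          l : high k ≤ IIₜ (suc k)
          l = s≤s⁻¹ (subst₂ _≤_ (sym (suc[2^n∸1]≡2^n k)) (sym Iᵦ≡) (m≤n+m (2 ^ k) (low k)))
          u : IIₜ (suc k) < high (suc k)
          u = subst₂ _≤_ (sym Iᵦ≡) (sym (high-suc k)) (+-monoˡ-≤ (2 ^ k) (<⇒≤ low<high))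
  incoming-Iᵦ⁻ (inj₂ (refl , refl)) =
    subst₂ (Edge (suc k) red) P₁-low-shift (sym (Iᵦ-suc n)) (shiftRed k low<high)

  incoming-Iᵦ : ∀ {c a} → Edge (suc k) c a (Iᵦ (suc k)) ⇔ ((c ≡ blue × a ≡ IIₜ (suc k)) ⊎ (c ≡ red × a ≡ IIᵦ (suc k)))
  incoming-Iᵦ = mk⇔ (λ e → incoming-Iᵦ⁺ e refl) incoming-Iᵦ⁻

mainTheorem6 : (k : ℕ) → 2 ≤ k →
    -- φ maps nodes of G_k to nodes of B₁ of G_{k+1}
    ((m : ℕ) → Node k m → B₁Node (suc k) (φ k m))
  × -- φ is injective on nodes of G_k
    ((m m′ : ℕ) → Node k m → Node k m′ → φ k m ≡ φ k m′ → m ≡ m′)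
  × -- φ is onto the nodes of B₁ of G_{k+1}
    ((n : ℕ) → B₁Node (suc k) n → ∃[ m ] (Node k m × φ k m ≡ n))
  × -- every edge of G_k other than the red edge 0 → 2^(k-1)-1 maps to an edge of B₁ of the same colour
    ((c : Colour) (a b : ℕ) → Edge k c a b → ¬ (c ≡ red × a ≡ 0 × b ≡ low k) →
       B₁Edge (suc k) c (φ k a) (φ k b))
  × -- every edge of B₁ of G_{k+1} arises this way
    ((c : Colour) (a′ b′ : ℕ) → B₁Edge (suc k) c a′ b′ →
       ∃[ a ] ∃[ b ] (Edge k c a b × ¬ (c ≡ red × a ≡ 0 × b ≡ low k)
                      × φ k a ≡ a′ × φ k b ≡ b′))
  × -- the incoming edges of Iᵦ^{k+1} in G_{k+1} are exactly: blue from IIₜ^{k+1}, red from IIᵦ^{k+1}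
    ((c : Colour) (a : ℕ) →
       Edge (suc k) c a (Iᵦ (suc k)) ⇔ ((c ≡ blue × a ≡ IIₜ (suc k)) ⊎ (c ≡ red × a ≡ IIᵦ (suc k))))
mainTheorem6 (suc n) (s≤s 1≤n) =
    (λ _ → φ-node)
  , (λ _ _ _ _ → φ-injective (suc n))
  , (λ _ → φ-onto)
  , (λ _ _ _ → φ-edge)
  , (λ _ _ _ → φ-edge-onto)
  , (λ _ _ → incoming-Iᵦ)
  where open Doubling n 1≤n
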